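{- For any connected graph $G$, $\chi_\rho''(G) \leq |V(G)|+|E(G)|-\max\{\alpha(G),\nu(G)\}+1$, where $\alpha(G)$ is the independence number and $\nu(G)$ the matching number of $G$. Moreover, the bound is sharp (for example, equality holds for every star $K_{1,n}$).
   Context: All graphs are simple, finite and undirected. The total graph $T(G)$ of a graph $G$ has vertex set $V(G)\cup E(G)$, where two elements are adjacent if they are adjacent vertices of $G$, incident edges of $G$ (sharing an endpoint), or a vertex and an edge of $G$ having that vertex as an endpoint. A packing total coloring of $G$ is a map $c:V(G)\cup E(G)\to\{1,2,\dots\}$ such that for any two distinct elements $A,B\in V(G)\cup E(G)$ with $c(A)=c(B)=i$, the distance between $A$ and $B$ in $T(G)$ is greater than $i$. The packing total chromatic number $\chi_\rho''(G)$ is the smallest $k$ such that $G$ has a packing total coloring with colors from $\{1,\dots,k\}$. -}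

module Defs where

open import Data.Nat using (ℕ; zero; suc; _+_; _∸_; _≤_; _<_; _⊔_; s≤s; z≤n)
open import Data.Fin using (Fin; toℕ) renaming (zero to fzero; suc to fsuc)
open import Data.Fin.Subset using (Subset; _∈_; ∣_∣)
open import Data.Fin.Properties using (suc-injective)
open import Data.Product using (Σ; ∃; _×_; _,_; proj₁; proj₂)
open import Data.Sum using (_⊎_; inj₁; inj₂)
open import Relation.Nullary using (¬_)
open import Relation.Binary.PropositionalEquality using (_≡_; _≢_; refl; cong)

record Graph : Set where
  field
    n      : ℕ
    m      : ℕ
    edge   : Fin m → Fin n × Fin n
    edge-< : ∀ e → toℕ (proj₁ (edge e)) < toℕ (proj₂ (edge e))
    edge-injective : ∀ e f → edge e ≡ edge f → e ≡ f
open Graph public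

Incident : (G : Graph) → Fin (n G) → Fin (m G) → Set
Incident G v e = (v ≡ proj₁ (edge G e)) ⊎ (v ≡ proj₂ (edge G e))

Adj : (G : Graph) → Fin (n G) → Fin (n G) → Set
Adj G u v = ∃ λ e → (edge G e ≡ (u , v)) ⊎ (edge G e ≡ (v , u))

ShareEnd : (G : Graph) → Fin (m G) → Fin (m G) → Set
ShareEnd G e f = ∃ λ v → Incident G v e × Incident G v f

data Walk {A : Set} (R : A → A → Set) : A → A → ℕ → Set where
  here : ∀ {x} → Walk R x x zero
  step : ∀ {x y z k} → R x y → Walk R y z k → Walk R x z (suc k)

Connected : Graph → Set
Connected G = ∀ u v → ∃ λ k → Walk (Adj G) u v k

-- elements of the total graph T(G): vertices and edges of G
Elem : Graph → Set
Elem G = Fin (n G) ⊎ Fin (m G)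

TAdj : (G : Graph) → Elem G → Elem G → Set
TAdj G (inj₁ u) (inj₁ v) = Adj G u v
TAdj G (inj₁ u) (inj₂ e) = Incident G u e
TAdj G (inj₂ e) (inj₁ u) = Incident G u e
TAdj G (inj₂ e) (inj₂ f) = (e ≢ f) × ShareEnd G e f

DistGreater : (G : Graph) → Elem G → Elem G → ℕ → Set
DistGreater G A B i = ∀ k → k ≤ i → ¬ Walk (TAdj G) A B k

IsPackingTotalColoring : (G : Graph) → ℕ → (Elem G → ℕ) → Set
IsPackingTotalColoring G k c =
  (∀ A → 1 ≤ c A × c A ≤ k) ×
  (∀ A B → A ≢ B → c A ≡ c B → DistGreater G A B (c A))

HasPTC : Graph → ℕ → Set
HasPTC G k = Σ (Elem G → ℕ) (IsPackingTotalColoring G k)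

IsPackingTotalChromaticNumber : Graph → ℕ → Set
IsPackingTotalChromaticNumber G k = HasPTC G k × (∀ j → j < k → ¬ HasPTC G j)

Independent : (G : Graph) → Subset (n G) → Set
Independent G S = ∀ u v → u ∈ S → v ∈ S → ¬ Adj G u v

IsIndependenceNumber : Graph → ℕ → Set
IsIndependenceNumber G a =
  (∃ λ S → Independent G S × ∣ S ∣ ≡ a) ×
  (∀ S → Independent G S → ∣ S ∣ ≤ a)

Matching : (G : Graph) → Subset (m G) → Set
Matching G M = ∀ e f → e ∈ M → f ∈ M → e ≢ f → ¬ ShareEnd G e f

IsMatchingNumber : Graph → ℕ → Set
IsMatchingNumber G ν =
  (∃ λ M → Matching G M × ∣ M ∣ ≡ ν) ×
  (∀ M → Matching G M → ∣ M ∣ ≤ ν)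

bound : Graph → ℕ → ℕ → ℕ
bound G a ν = n G + m G ∸ (a ⊔ ν) + 1

star : ℕ → Graph
star k = record
  { n = suc k
  ; m = k
  ; edge = λ i → (fzero , fsuc i)
  ; edge-< = λ i → s≤s z≤n
  ; edge-injective = λ e f eq → suc-injective (cong proj₂ eq)
  }

-- Upper bound: if T is a set of vertices and edges no two of which are adjacent in the total
-- graph, colour all of T with 1 and give every other element its own colour 2, 3, …; this is a
-- packing total colouring with |V| + |E| − |T| + 1 colours.  An independent set of vertices and
-- a matching are such sets T.
-- Sharpness for K_{1,k}: the centre, the k spokes and one leaf L are pairwise at distance at
-- most 2 in the total graph and the only non-adjacent pairs are L with the spokes other than
-- its own, so two of them can share a colour only if it is 1 and they form such a pair.
-- Choosing L as the leaf of the spoke coloured 1 (there is at most one) rules this out, so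
-- k + 2 colours are needed, while the bound is at most k + 2 since the k leaves are independent.
module Submission where

open import Data.Nat using (ℕ; zero; suc; _+_; _∸_; _≤_; _⊔_; s≤s; z≤n)
import Data.Nat as ℕ
open import Data.Nat.Properties
  using (module ≤-Reasoning; m≤n+m; +-∸-assoc; ≤-total; ≤-trans; ∸-monoʳ-≤; m+n∸n≡m; +-monoˡ-≤;
         +-comm; +-identityʳ; m≤m⊔n; m≥n⇒m⊔n≡m; m≤n⇒m⊔n≡n; <-≤-trans; ≤⇒≯; ≮⇒≥)
open import Data.Bool using (true; false)
open import Data.Fin using (Fin; toℕ; fromℕ<; join; _≟_) renaming (zero to fzero; suc to fsuc)
import Data.Fin as Fin
open import Data.Fin.Properties using (splitAt-join; toℕ-fromℕ<; pigeonhole; any?; <⇒≢)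
open import Data.Fin.Subset using (Subset; ∣_∣; _∈_; ⊥; ⊤)
open import Data.Fin.Subset.Properties using (∣p∣≤n; ∣⊥∣≡0; ∣⊤∣≡n; ∉⊥)
open import Data.Vec using ([]; _∷_; _++_; here; there)
open import Data.Product using (Σ; _×_; _,_; proj₁; proj₂)
open import Data.Sum using (inj₁; inj₂; [_,_]′)
open import Relation.Nullary using (¬_; yes; no; contradiction)
open import Relation.Binary.PropositionalEquality
  using (_≡_; _≢_; refl; sym; trans; cong; subst; module ≡-Reasoning)
open import Defs

-- Prepending an element outside the subset: colour 1 stays, the colours ≥ 2 move up by one.
shift : ℕ → ℕ
shift (suc zero) = 1
shift k          = suc k

shift≤suc : ∀ {x y} → x ≤ y → shift x ≤ suc y
shift≤suc {zero}          _   = s≤s z≤n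
shift≤suc {suc zero}      _   = s≤s z≤n
shift≤suc {suc (suc x)} x≤y = s≤s x≤y

shift-≥1 : ∀ x → 1 ≤ shift x
shift-≥1 zero          = s≤s z≤n
shift-≥1 (suc zero)    = s≤s z≤n
shift-≥1 (suc (suc x)) = s≤s z≤n

shift≢2 : ∀ x → shift x ≢ 2
shift≢2 (suc (suc zero)) ()

shift-injective : ∀ {x y} → 2 ≤ shift x → shift x ≡ shift y → x ≡ y × 2 ≤ x
shift-injective {zero}        (s≤s ())
shift-injective {suc zero}    (s≤s ())
shift-injective {suc (suc x)} {suc zero} _ ()
shift-injective {suc (suc x)} {suc (suc .x)} _ refl = refl , s≤s (s≤s z≤n)

rankColour : ∀ {N} → Subset N → Fin N → ℕ
rankColour (true  ∷ T) fzero    = 1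
rankColour (false ∷ T) fzero    = 2
rankColour (true  ∷ T) (fsuc i) = rankColour T i
rankColour (false ∷ T) (fsuc i) = shift (rankColour T i)

rankColour-≥1 : ∀ {N} (T : Subset N) i → 1 ≤ rankColour T i
rankColour-≥1 (true  ∷ T) fzero    = s≤s z≤n
rankColour-≥1 (false ∷ T) fzero    = s≤s z≤n
rankColour-≥1 (true  ∷ T) (fsuc i) = rankColour-≥1 T i
rankColour-≥1 (false ∷ T) (fsuc i) = shift-≥1 (rankColour T i)

rankColour-≤ : ∀ {N} (T : Subset N) i → rankColour T i ≤ N ∸ ∣ T ∣ + 1
rankColour-≤ {suc N} (true  ∷ T) fzero    = m≤n+m 1 (N ∸ ∣ T ∣)
rankColour-≤ {suc N} (true  ∷ T) (fsuc i) = rankColour-≤ T i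
rankColour-≤ {suc N} (false ∷ T) i
  rewrite +-∸-assoc 1 (∣p∣≤n T) with i
... | fzero  = s≤s (m≤n+m 1 (N ∸ ∣ T ∣))
... | fsuc j = shift≤suc (rankColour-≤ T j)

rankColour≡1⇒∈ : ∀ {N} (T : Subset N) i → rankColour T i ≡ 1 → i ∈ T
rankColour≡1⇒∈ (true  ∷ T) fzero    _ = here
rankColour≡1⇒∈ (true  ∷ T) (fsuc i) c≡1 = there (rankColour≡1⇒∈ T i c≡1)
rankColour≡1⇒∈ (false ∷ T) (fsuc i) c≡1
  with rankColour T i | rankColour-≥1 T i | rankColour≡1⇒∈ T i
... | suc zero | _ | ∈T = there (∈T refl)

rankColour-injective : ∀ {N} (T : Subset N) i j →
  2 ≤ rankColour T i → rankColour T i ≡ rankColour T j → i ≡ j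
rankColour-injective (true  ∷ T) fzero    fzero    _  _  = refl
rankColour-injective (true  ∷ T) fzero    (fsuc j) (s≤s ())
rankColour-injective (true  ∷ T) (fsuc i) fzero    2≤c c≡1 =
  contradiction (subst (2 ≤_) c≡1 2≤c) λ { (s≤s ()) }
rankColour-injective (true  ∷ T) (fsuc i) (fsuc j) 2≤c eq =
  cong fsuc (rankColour-injective T i j 2≤c eq)
rankColour-injective (false ∷ T) fzero    fzero    _  _  = refl
rankColour-injective (false ∷ T) fzero    (fsuc j) _  eq =
  contradiction (sym eq) (shift≢2 (rankColour T j))
rankColour-injective (false ∷ T) (fsuc i) fzero    _  eq =
  contradiction eq (shift≢2 (rankColour T i))
rankColour-injective (false ∷ T) (fsuc i) (fsuc j) 2≤c eq =
  let i≡j , 2≤ci = shift-injective {rankColour T i} 2≤c eq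
  in cong fsuc (rankColour-injective T i j 2≤ci i≡j)

∣p++q∣≡∣p∣+∣q∣ : ∀ {a b} (p : Subset a) (q : Subset b) → ∣ p ++ q ∣ ≡ ∣ p ∣ + ∣ q ∣
∣p++q∣≡∣p∣+∣q∣ []          q = refl
∣p++q∣≡∣p∣+∣q∣ (true  ∷ p) q = cong suc (∣p++q∣≡∣p∣+∣q∣ p q)
∣p++q∣≡∣p∣+∣q∣ (false ∷ p) q = ∣p++q∣≡∣p∣+∣q∣ p q

join∈p++q⁻ : ∀ {a b} (p : Subset a) (q : Subset b) x → join a b x ∈ p ++ q → [ _∈ p , _∈ q ]′ x
join∈p++q⁻ []      q (inj₂ y)        y∈q       = y∈q
join∈p++q⁻ (_ ∷ p) q (inj₁ fzero)    here      = here
join∈p++q⁻ (_ ∷ p) q (inj₁ (fsuc x)) (there i) = there (join∈p++q⁻ p q (inj₁ x) i)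
join∈p++q⁻ (_ ∷ p) q (inj₂ y)        (there i) = join∈p++q⁻ p q (inj₂ y) i

join-injective : ∀ a b {x y} → join a b x ≡ join a b y → x ≡ y
join-injective a b {x} {y} eq = begin
  x                          ≡⟨ sym (splitAt-join a b x) ⟩
  Fin.splitAt a (join a b x) ≡⟨ cong (Fin.splitAt a) eq ⟩
  Fin.splitAt a (join a b y) ≡⟨ splitAt-join a b y ⟩
  y                          ∎
  where open ≡-Reasoning

TotallyIndependent : (G : Graph) → Subset (n G) → Subset (m G) → Set
TotallyIndependent G S M =
  ∀ A B → A ≢ B → [ _∈ S , _∈ M ]′ A → [ _∈ S , _∈ M ]′ B → ¬ TAdj G A B

independent⇒totallyIndependent : ∀ G {S} → Independent G S → TotallyIndependent G S ⊥
independent⇒totallyIndependent G indep (inj₁ u) (inj₁ v) _ u∈S v∈S = indep u v u∈S v∈S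
independent⇒totallyIndependent G indep (inj₁ u) (inj₂ f) _ _   f∈⊥ = contradiction f∈⊥ ∉⊥
independent⇒totallyIndependent G indep (inj₂ e) _        _ e∈⊥ _   = contradiction e∈⊥ ∉⊥

matching⇒totallyIndependent : ∀ G {M} → Matching G M → TotallyIndependent G ⊥ M
matching⇒totallyIndependent G match (inj₂ e) (inj₂ f) _ e∈M f∈M (e≢f , share) =
  match e f e∈M f∈M e≢f share
matching⇒totallyIndependent G match (inj₂ e) (inj₁ v) _ _   v∈⊥ = contradiction v∈⊥ ∉⊥
matching⇒totallyIndependent G match (inj₁ u) _        _ u∈⊥ _   = contradiction u∈⊥ ∉⊥

nonAdjacent⇒distGreater1 : ∀ G {A B} → A ≢ B → ¬ TAdj G A B → DistGreater G A B 1
nonAdjacent⇒distGreater1 G A≢B _     zero          _        here          = A≢B refl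
nonAdjacent⇒distGreater1 G _   ¬A~B (suc zero)    _        (step A~B here) = ¬A~B A~B
nonAdjacent⇒distGreater1 G _   _    (suc (suc k)) (s≤s ())

totallyIndependent⇒hasPTC : ∀ G (S : Subset (n G)) (M : Subset (m G)) →
  TotallyIndependent G S M → HasPTC G (n G + m G ∸ (∣ S ∣ + ∣ M ∣) + 1)
totallyIndependent⇒hasPTC G S M indep = c , (λ A → rankColour-≥1 T (index A) , c≤bound A) , packing
  where
  T = S ++ M

  index : Elem G → Fin (n G + m G)
  index = join (n G) (m G)

  c : Elem G → ℕ
  c A = rankColour T (index A)

  c≤bound : ∀ A → c A ≤ n G + m G ∸ (∣ S ∣ + ∣ M ∣) + 1
  c≤bound A = subst (λ t → c A ≤ n G + m G ∸ t + 1) (∣p++q∣≡∣p∣+∣q∣ S M) (rankColour-≤ T (index A))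

  colour1⇒∈ : ∀ A → c A ≡ 1 → [ _∈ S , _∈ M ]′ A
  colour1⇒∈ A cA≡1 = join∈p++q⁻ S M A (rankColour≡1⇒∈ T (index A) cA≡1)

  packing : ∀ A B → A ≢ B → c A ≡ c B → DistGreater G A B (c A)
  packing A B A≢B cA≡cB with c A in cA≡ | rankColour-≥1 T (index A)
  ... | suc zero    | _ = nonAdjacent⇒distGreater1 G A≢B
          (indep A B A≢B (colour1⇒∈ A cA≡) (colour1⇒∈ B (sym cA≡cB)))
  ... | suc (suc _) | _ = contradiction
          (join-injective (n G) (m G)
            (rankColour-injective T (index A) (index B)
              (subst (2 ≤_) (sym cA≡) (s≤s (s≤s z≤n))) (trans cA≡ cA≡cB)))
          A≢B

hasPTC-bound : ∀ G a ν → IsIndependenceNumber G a → IsMatchingNumber G ν → HasPTC G (bound G a ν)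
hasPTC-bound G a ν ((S , indep , ∣S∣≡a) , _) ((M , match , ∣M∣≡ν) , _) with ≤-total ν a
... | inj₁ ν≤a = subst (λ t → HasPTC G (n G + m G ∸ t + 1)) size
  (totallyIndependent⇒hasPTC G S ⊥ (independent⇒totallyIndependent G indep))
  where
  open ≡-Reasoning
  size : ∣ S ∣ + ∣ ⊥ {m G} ∣ ≡ a ⊔ ν
  size = begin
    ∣ S ∣ + ∣ ⊥ {m G} ∣ ≡⟨ cong (∣ S ∣ +_) (∣⊥∣≡0 (m G)) ⟩
    ∣ S ∣ + 0           ≡⟨ +-identityʳ ∣ S ∣ ⟩
    ∣ S ∣               ≡⟨ ∣S∣≡a ⟩
    a                   ≡⟨ sym (m≥n⇒m⊔n≡m ν≤a) ⟩
    a ⊔ ν               ∎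
... | inj₂ a≤ν = subst (λ t → HasPTC G (n G + m G ∸ t + 1)) size
  (totallyIndependent⇒hasPTC G ⊥ M (matching⇒totallyIndependent G match))
  where
  open ≡-Reasoning
  size : ∣ ⊥ {n G} ∣ + ∣ M ∣ ≡ a ⊔ ν
  size = begin
    ∣ ⊥ {n G} ∣ + ∣ M ∣ ≡⟨ cong (_+ ∣ M ∣) (∣⊥∣≡0 (n G)) ⟩
    ∣ M ∣               ≡⟨ ∣M∣≡ν ⟩
    ν                   ≡⟨ sym (m≤n⇒m⊔n≡n a≤ν) ⟩
    a ⊔ ν               ∎

distinctColours⇒≤ : ∀ {N j} (f : Fin N → ℕ) → (∀ x → 1 ≤ f x × f x ≤ j) →
  (∀ {x y} → x Fin.< y → f x ≢ f y) → N ≤ j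
distinctColours⇒≤ {N} {j} f range distinct = ≮⇒≥ λ j<N →
  let x , y , x<y , gx≡gy = pigeonhole j<N g
  in distinct x<y (begin
       f x                ≡⟨ sym (suc-toℕ-asFin (range x)) ⟩
       suc (toℕ (g x))    ≡⟨ cong (λ z → suc (toℕ z)) gx≡gy ⟩
       suc (toℕ (g y))    ≡⟨ suc-toℕ-asFin (range y) ⟩
       f y                ∎)
  where
  open ≡-Reasoning

  asFin : ∀ {c} → 1 ≤ c × c ≤ j → Fin j
  asFin {suc c} (_ , c<j) = fromℕ< c<j

  suc-toℕ-asFin : ∀ {c} (c∈[1,j] : 1 ≤ c × c ≤ j) → suc (toℕ (asFin c∈[1,j])) ≡ c
  suc-toℕ-asFin {suc c} (_ , c<j) = cong suc (toℕ-fromℕ< c<j)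

  g : Fin N → Fin j
  g x = asFin (range x)

module _ {G k c} (ptc : IsPackingTotalColoring G k c) where

  adjacent⇒colour≢ : ∀ {A B} → A ≢ B → TAdj G A B → c A ≢ c B
  adjacent⇒colour≢ {A} {B} A≢B A~B cA≡cB =
    proj₂ ptc A B A≢B cA≡cB 1 (proj₁ (proj₁ ptc A)) (step A~B here)

  commonNeighbour⇒colour≡1 : ∀ {A B C} → A ≢ B → TAdj G A C → TAdj G C B → c A ≡ c B → c A ≡ 1
  commonNeighbour⇒colour≡1 {A} {B} A≢B A~C C~B cA≡cB with c A in cA≡ | proj₁ (proj₁ ptc A)
  ... | suc zero    | _ = refl
  ... | suc (suc _) | _ = contradiction (step A~C (step C~B here))
          (proj₂ ptc A B A≢B (trans cA≡ cA≡cB) 2 (subst (2 ≤_) (sym cA≡) (s≤s (s≤s z≤n))))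

module Star {k j c} (ptc : IsPackingTotalColoring (star k) j c) where

  centre : Elem (star k)
  centre = inj₁ fzero

  leaf : Fin k → Elem (star k)
  leaf i = inj₁ (fsuc i)

  spoke : Fin k → Elem (star k)
  spoke = inj₂

  spokes-adjacent : ∀ {i i′} → i ≢ i′ → TAdj (star k) (spoke i) (spoke i′)
  spokes-adjacent i≢i′ = i≢i′ , fzero , inj₁ refl , inj₁ refl

  spokeColour1-unique : ∀ {i i′} → c (spoke i) ≡ 1 → c (spoke i′) ≡ 1 → i ≡ i′
  spokeColour1-unique {i} {i′} ci≡1 ci′≡1 with i ≟ i′
  ... | yes i≡i′ = i≡i′
  ... | no  i≢i′ = contradiction (trans ci≡1 (sym ci′≡1))
          (adjacent⇒colour≢ ptc (λ { refl → i≢i′ refl }) (spokes-adjacent i≢i′))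

  specialSpoke : 1 ≤ k → Σ (Fin k) λ L → ∀ i → c (spoke i) ≡ 1 → i ≡ L
  specialSpoke 1≤k with any? (λ i → c (spoke i) ℕ.≟ 1)
  ... | yes (L , cL≡1) = L , λ i ci≡1 → spokeColour1-unique ci≡1 cL≡1
  ... | no  none       = fromℕ< 1≤k , λ i ci≡1 → contradiction (i , ci≡1) none

  leaf≢spoke : ∀ {L} → (∀ i → c (spoke i) ≡ 1 → i ≡ L) → ∀ i → c (leaf L) ≢ c (spoke i)
  leaf≢spoke {L} only i with i ≟ L
  ... | yes refl = adjacent⇒colour≢ ptc (λ ()) (inj₂ refl)
  ... | no  i≢L  = λ cL≡ci → i≢L (only i (trans (sym cL≡ci)
          (commonNeighbour⇒colour≡1 ptc {C = spoke L} (λ ()) (inj₂ refl)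
            (spokes-adjacent (λ L≡i → i≢L (sym L≡i))) cL≡ci)))

  clique : Fin k → Fin (suc (suc k)) → Elem (star k)
  clique L fzero           = centre
  clique L (fsuc fzero)    = leaf L
  clique L (fsuc (fsuc i)) = spoke i

  clique-distinctColours : ∀ {L} → (∀ i → c (spoke i) ≡ 1 → i ≡ L) →
    ∀ {x y} → x Fin.< y → c (clique L x) ≢ c (clique L y)
  clique-distinctColours {L} only {fzero} {fsuc fzero} _ =
    adjacent⇒colour≢ ptc (λ ()) (L , inj₁ refl)
  clique-distinctColours only {fzero} {fsuc (fsuc i)} _ =
    adjacent⇒colour≢ ptc (λ ()) (inj₁ refl)
  clique-distinctColours only {fsuc fzero} {fsuc fzero} (s≤s ())
  clique-distinctColours only {fsuc fzero} {fsuc (fsuc i)} _ = leaf≢spoke only i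
  clique-distinctColours only {fsuc (fsuc i)} {fsuc (fsuc i′)} (s≤s (s≤s i<i′)) =
    adjacent⇒colour≢ ptc (λ { refl → <⇒≢ i<i′ refl }) (spokes-adjacent (<⇒≢ i<i′))

  colours-≥k+2 : 1 ≤ k → suc (suc k) ≤ j
  colours-≥k+2 1≤k = distinctColours⇒≤ (λ x → c (clique L x)) (λ x → proj₁ ptc (clique L x))
                    (clique-distinctColours only)
    where
    L = proj₁ (specialSpoke 1≤k)
    only = proj₂ (specialSpoke 1≤k)

leaves-independent : ∀ k → Independent (star k) (false ∷ ⊤)
leaves-independent k (fsuc u) (fsuc v) _ _ (_ , inj₁ ())
leaves-independent k (fsuc u) (fsuc v) _ _ (_ , inj₂ ())

star-bound≤ : ∀ {k a ν} → IsIndependenceNumber (star k) a → bound (star k) a ν ≤ suc (suc k)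
star-bound≤ {k} {a} {ν} (_ , maximal) = begin
  suc k + k ∸ (a ⊔ ν) + 1 ≤⟨ +-monoˡ-≤ 1 (∸-monoʳ-≤ (suc k + k) (≤-trans k≤a (m≤m⊔n a ν))) ⟩
  suc k + k ∸ k + 1       ≡⟨ cong (_+ 1) (m+n∸n≡m (suc k) k) ⟩
  suc k + 1               ≡⟨ +-comm (suc k) 1 ⟩
  suc (suc k)             ∎
  where
  open ≤-Reasoning
  k≤a : k ≤ a
  k≤a = subst (_≤ a) (∣⊤∣≡n k) (maximal (false ∷ ⊤) (leaves-independent k))

proposition2p3 : ((G : Graph) → Connected G → ∀ a ν → IsIndependenceNumber G a → IsMatchingNumber G ν →
    HasPTC G (bound G a ν))
    × (∀ k → 1 ≤ k → ∀ a ν → IsIndependenceNumber (star k) a → IsMatchingNumber (star k) ν →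
    IsPackingTotalChromaticNumber (star k) (bound (star k) a ν))
proposition2p3 = (λ G _ → hasPTC-bound G) , sharp
  where
  sharp : ∀ k → 1 ≤ k → ∀ a ν → IsIndependenceNumber (star k) a → IsMatchingNumber (star k) ν →
    IsPackingTotalChromaticNumber (star k) (bound (star k) a ν)
  sharp k 1≤k a ν isα isν = hasPTC-bound (star k) a ν isα isν , λ j j<bound (_ , ptc) →
    ≤⇒≯ (Star.colours-≥k+2 ptc 1≤k) (<-≤-trans j<bound (star-bound≤ isα))
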